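{- For all positive integers $n$, $$L_{2n-1}=U^{(0)}\{L_{2n-2}\}\quad\text{and}\quad L_{2n}=U^{(1)}\{L_{2n-1}\}.$$
   Context: $(a;b)_\infty=\prod_{k\ge 0}(1-ab^k)$. Define integers $a(m)$ by $\sum_{m\ge 0}a(m)q^m=\dfrac{(q^2;q^2)^5_{\infty}}{(q;q)^3_{\infty}(q^4;q^4)^2_{\infty}}$. Let $\lambda_{2n-1}=\frac{19\cdot 5^{2n-1}+1}{24}$ and $\lambda_{2n}=\frac{23\cdot 5^{2n}+1}{24}$. Define $L_0=1$ and for $n\ge 1$ $$L_{2n-1}=\frac{(q^5;q^5)^3_{\infty}(q^{20};q^{20})^2_{\infty}}{(q^{10};q^{10})^5_{\infty}}\sum_{m=0}^{\infty} a(5^{2n-1}m+\lambda_{2n-1})q^{m+1},\qquad L_{2n}=\frac{(q;q)^3_{\infty}(q^{4};q^{4})^2_{\infty}}{(q^{2};q^{2})^5_{\infty}}\sum_{m=0}^{\infty} a(5^{2n}m+\lambda_{2n})q^{m+1}.$$ For a Laurent series $f=\sum_{m\ge M}c(m)q^m$ define $U_5\{f\}=\sum_{5m\ge M}c(5m)q^m$. Let $$A(q)=q\frac{(q^{2};q^{2})^5_{\infty}}{(q;q)^3_{\infty}(q^{4};q^{4})^2_{\infty}}\cdot \frac{(q^{25};q^{25})^3_{\infty}(q^{100};q^{100})^2_{\infty}}{(q^{50};q^{50})^5_{\infty}},$$ and define $U^{(0)}\{f\}=U_5\{A(q)f\}$ and $U^{(1)}\{f\}=U_5\{f\}$. -}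

module Defs where

open import Data.Nat using (ℕ; zero; suc; _∸_; _^_)
import Data.Nat as ℕ
open import Data.Nat.Divisibility using (_∣?_)
open import Data.Nat.DivMod using (_/_)
open import Data.Integer using (ℤ; +_; -[1+_]; -_)
import Data.Integer as ℤ
open import Relation.Nullary using (yes; no)
open import Relation.Binary.PropositionalEquality using (_≡_)

-- Formal power series with integer coefficients: k ↦ coefficient of q^k.
-- (All series in the statement have only nonnegative exponents.)
Series : Set
Series = ℕ → ℤ

_≈_ : Series → Series → Set
f ≈ g = ∀ k → f k ≡ g k
infix 4 _≈_

one : Series
one zero    = + 1
one (suc _) = + 0

qShift : Series → Series
qShift f zero    = + 0
qShift f (suc k) = f k

sumTo : ℕ → (ℕ → ℤ) → ℤ
sumTo zero    f = + 0
sumTo (suc n) f = sumTo n f ℤ.+ f n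

_⊛_ : Series → Series → Series
(f ⊛ g) k = sumTo (suc k) (λ i → f i ℤ.* g (k ∸ i))
infixl 7 _⊛_

pow : Series → ℕ → Series
pow f zero    = one
pow f (suc n) = f ⊛ pow f n

-- The polynomial 1 - q^d   (used only for d ≥ 1).
oneMinusQ : ℕ → Series
oneMinusQ d k with k ℕ.≟ 0
... | yes _ = + 1
... | no _ with k ℕ.≟ d
...   | yes _ = - (+ 1)
...   | no _  = + 0

-- The series 1/(1 - q^d) = Σ_m q^{dm}   (used only for d ≥ 1).
geom : ℕ → Series
geom d k with d ∣? k
... | yes _ = + 1
... | no _  = + 0

factor : ℕ → ℤ → Series
factor d (+ n)     = pow (oneMinusQ d) n
factor d -[1+ n ]  = pow (geom d) (suc n)

etaTrunc : ℕ → ℤ → ℕ → Series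
etaTrunc a e zero    = one
etaTrunc a e (suc N) = etaTrunc a e N ⊛ factor (a ℕ.* suc N) e

-- (q^a;q^a)_∞^e = ∏_{j≥1} (1 - q^{a j})^e, for a ≥ 1.  Its coefficient
-- of q^k equals that of the truncation at N = k (factors with a j > k
-- do not affect coefficients up to q^k).
eta : ℕ → ℤ → Series
eta a e k = etaTrunc a e k k

aGF : Series
aGF = eta 2 (+ 5) ⊛ eta 1 (- (+ 3)) ⊛ eta 4 (- (+ 2))

a : ℕ → ℤ
a m = aGF m

λodd : ℕ → ℕ
λodd n = (19 ℕ.* 5 ^ (2 ℕ.* n ∸ 1) ℕ.+ 1) / 24

λeven : ℕ → ℕ
λeven n = (23 ℕ.* 5 ^ (2 ℕ.* n) ℕ.+ 1) / 24

shiftedSum : (ℕ → ℤ) → Series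
shiftedSum c = qShift c

-- L_{2n-1}  (meaningful for n ≥ 1)
Lodd : ℕ → Series
Lodd n = (eta 5 (+ 3) ⊛ eta 20 (+ 2) ⊛ eta 10 (- (+ 5)))
         ⊛ shiftedSum (λ m → a (5 ^ (2 ℕ.* n ∸ 1) ℕ.* m ℕ.+ λodd n))

Leven : ℕ → Series
Leven zero = one
Leven (suc k) = (eta 1 (+ 3) ⊛ eta 4 (+ 2) ⊛ eta 2 (- (+ 5)))
                ⊛ shiftedSum (λ m → a (5 ^ (2 ℕ.* suc k) ℕ.* m ℕ.+ λeven (suc k)))

U5 : Series → Series
U5 f m = f (5 ℕ.* m)

Aq : Series
Aq = qShift (aGF ⊛ (eta 25 (+ 3) ⊛ eta 100 (+ 2) ⊛ eta 50 (- (+ 5))))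

U⁰ : Series → Series
U⁰ f = U5 (Aq ⊛ f)

U¹ : Series → Series
U¹ f = U5 f

module Submission where

-- The two recurrences  L_{2n-1} = U⁰ L_{2n-2}  and  L_{2n} = U¹ L_{2n-1}
-- follow from three facts about formal power series, plus index arithmetic.
--   (1) Writing Q_a = (q^a;q^a)^3 (q^{4a};q^{4a})^2 / (q^{2a};q^{2a})^5, the
--       generating function of a(m) satisfies a(q) Q_1 = 1, because each
--       eta factor meets its inverse (eta-inverse, aGF-⊛-Q₁).
--   (2) Q_{5a} = Q_a(q^5), because the substitution q ↦ q^n is a
--       multiplicative map sending (q^A;q^A)_∞^e to (q^{An};q^{An})_∞^e
--       (dilate-⊛-dilate, dilate-eta).
--   (3) U_n (f(q^n) g) = f · U_n g  (U-dilate).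
-- Hence U⁰ (Q_1 W) = Q_5 · U_5(q W) and U¹ (Q_5 X) = Q_1 · U_5 X, and it
-- remains to see that U_5 picks out the right subsequences of a(m): the
-- offsets λ satisfy λ_{2n} + 3·5^{2n} = λ_{2n+1} and λ_{2n-1} + 4·5^{2n-1} = λ_{2n}.

open import Defs
open import Data.Nat as ℕ using (ℕ; zero; suc; _∸_; _^_; NonZero; z≤n; s≤s)
import Data.Nat.Properties as ℕP
open import Data.Nat.Divisibility
  using (_∣_; _∣?_; _∣0; divides; ∣⇒≤; ∣m∣n⇒∣m+n; ∣m+n∣m⇒∣n; n∣n; n∣m*n; m*n∣⇒n∣; *-monoˡ-∣; *-cancelʳ-∣)
open import Data.Nat.DivMod using (_/_; _%_; m≡m%n+[m/n]*n; m%n<n; +-distrib-/-∣ˡ; m*n/n≡m)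
import Data.Nat.Tactic.RingSolver as ℕSolver
open import Data.Integer using (ℤ; +_; -[1+_]; -_; _+_; _*_; -1ℤ)
import Data.Integer.Properties as ℤP
open import Data.Integer.Tactic.RingSolver using (solve-∀)
open import Data.Product using (_×_; _,_)
open import Data.Empty using (⊥-elim)
open import Relation.Nullary using (¬_; Dec; yes; no)
open import Relation.Binary.PropositionalEquality
open import Function using (_∘_)
open import Level using (0ℓ)
open import Algebra.Bundles using (CommutativeMonoid)
import Algebra.Properties.CommutativeSemigroup as CommSemigroupProperties
import Relation.Binary.Reasoning.Setoid as SetoidReasoning
import Algebra.Solver.CommutativeMonoid as CommMonoidSolver

sumTo-cong : ∀ n {f g : ℕ → ℤ} → (∀ i → i ℕ.< n → f i ≡ g i) → sumTo n f ≡ sumTo n g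
sumTo-cong zero    eq = refl
sumTo-cong (suc n) eq = cong₂ _+_ (sumTo-cong n (λ i i<n → eq i (ℕP.m<n⇒m<1+n i<n))) (eq n ℕP.≤-refl)

sumTo-zero : ∀ n {f : ℕ → ℤ} → (∀ i → i ℕ.< n → f i ≡ + 0) → sumTo n f ≡ + 0
sumTo-zero zero    eq = refl
sumTo-zero (suc n) eq = cong₂ _+_ (sumTo-zero n (λ i i<n → eq i (ℕP.m<n⇒m<1+n i<n))) (eq n ℕP.≤-refl)

sumTo-+ : ∀ n (f g : ℕ → ℤ) → sumTo n (λ i → f i + g i) ≡ sumTo n f + sumTo n g
sumTo-+ zero    f g = refl
sumTo-+ (suc n) f g = trans (cong (_+ (f n + g n)) (sumTo-+ n f g)) (swap (sumTo n f) (sumTo n g) (f n) (g n))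
  where
  swap : ∀ a b c d → (a + b) + (c + d) ≡ (a + c) + (b + d)
  swap = solve-∀

sumTo-*ˡ : ∀ n c (f : ℕ → ℤ) → sumTo n (λ i → c * f i) ≡ c * sumTo n f
sumTo-*ˡ zero    c f = sym (ℤP.*-zeroʳ c)
sumTo-*ˡ (suc n) c f = trans (cong (_+ c * f n) (sumTo-*ˡ n c f)) (sym (ℤP.*-distribˡ-+ c (sumTo n f) (f n)))

sumTo-head : ∀ n (f : ℕ → ℤ) → sumTo (suc n) f ≡ f 0 + sumTo n (f ∘ suc)
sumTo-head zero    f = ℤP.+-comm (+ 0) (f 0)
sumTo-head (suc n) f = trans (cong (_+ f (suc n)) (sumTo-head n f)) (ℤP.+-assoc (f 0) _ _)

-- Summing in reverse order; this is what makes convolution commutative.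
sumTo-reverse : ∀ n (f : ℕ → ℤ) → sumTo n f ≡ sumTo n (λ i → f (n ∸ suc i))
sumTo-reverse zero    f = refl
sumTo-reverse (suc n) f = begin
  sumTo n f + f n                          ≡⟨ cong (_+ f n) (sumTo-reverse n f) ⟩
  sumTo n (λ i → f (n ∸ suc i)) + f n      ≡⟨ ℤP.+-comm _ (f n) ⟩
  f n + sumTo n (λ i → f (n ∸ suc i))      ≡⟨ sym (sumTo-head n (λ i → f (suc n ∸ suc i))) ⟩
  sumTo (suc n) (λ i → f (suc n ∸ suc i))  ∎
  where open ≡-Reasoning

tail : Series → Series
tail f k = f (suc k)

_⊞_ : Series → Series → Series
(f ⊞ g) k = f k + g k

infixr 7 _·_
_·_ : ℤ → Series → Series
(c · f) k = c * f k

shiftN : ℕ → Series → Series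
shiftN zero    f = f
shiftN (suc d) f = qShift (shiftN d f)

⊛-cong-upTo : ∀ k {f f′ g g′ : Series} → (∀ i → i ℕ.≤ k → f i ≡ f′ i) → (∀ i → i ℕ.≤ k → g i ≡ g′ i) →
              (f ⊛ g) k ≡ (f′ ⊛ g′) k
⊛-cong-upTo k eqf eqg =
  sumTo-cong (suc k) (λ i i≤k → cong₂ _*_ (eqf i (ℕP.≤-pred i≤k)) (eqg (k ∸ i) (ℕP.m∸n≤m k i)))

⊛-cong : ∀ {f f′ g g′ : Series} → f ≈ f′ → g ≈ g′ → f ⊛ g ≈ f′ ⊛ g′
⊛-cong eqf eqg k = ⊛-cong-upTo k (λ i _ → eqf i) (λ i _ → eqg i)

⊛-congˡ : ∀ f {g g′ : Series} → g ≈ g′ → f ⊛ g ≈ f ⊛ g′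
⊛-congˡ f = ⊛-cong {f} {f} (λ _ → refl)

⊛-congʳ : ∀ {f f′ : Series} g → f ≈ f′ → f ⊛ g ≈ f′ ⊛ g
⊛-congʳ g f≈f′ = ⊛-cong {g = g} {g′ = g} f≈f′ (λ _ → refl)

⊛-comm : ∀ (f g : Series) → f ⊛ g ≈ g ⊛ f
⊛-comm f g k = trans (sumTo-reverse (suc k) _) (sumTo-cong (suc k) swap)
  where
  swap : ∀ i → i ℕ.< suc k → f (k ∸ i) * g (k ∸ (k ∸ i)) ≡ g i * f (k ∸ i)
  swap i i≤k = trans (cong (λ j → f (k ∸ i) * g j) (ℕP.m∸[m∸n]≡n (ℕP.≤-pred i≤k))) (ℤP.*-comm (f (k ∸ i)) (g i))

one-suc : ∀ j → 0 ℕ.< j → one j ≡ + 0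
one-suc (suc j) _ = refl

⊛-identityʳ : ∀ (f : Series) → f ⊛ one ≈ f
⊛-identityʳ f k = begin
  sumTo k (λ i → f i * one (k ∸ i)) + f k * one (k ∸ k)
    ≡⟨ cong₂ _+_ (sumTo-zero k vanish) (cong (λ j → f k * one j) (ℕP.n∸n≡0 k)) ⟩
  + 0 + f k * + 1                                       ≡⟨ trans (ℤP.+-identityˡ _) (ℤP.*-identityʳ (f k)) ⟩
  f k                                                   ∎
  where
  open ≡-Reasoning
  vanish : ∀ i → i ℕ.< k → f i * one (k ∸ i) ≡ + 0
  vanish i i<k = trans (cong (f i *_) (one-suc (k ∸ i) (ℕP.m<n⇒0<n∸m i<k))) (ℤP.*-zeroʳ (f i))

⊛-identityˡ : ∀ (f : Series) → one ⊛ f ≈ f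
⊛-identityˡ f k = trans (⊛-comm one f k) (⊛-identityʳ f k)

⊛-distribʳ : ∀ (f g h : Series) → (f ⊞ g) ⊛ h ≈ (f ⊛ h) ⊞ (g ⊛ h)
⊛-distribʳ f g h k = trans (sumTo-cong (suc k) (λ i _ → ℤP.*-distribʳ-+ (h (k ∸ i)) (f i) (g i))) (sumTo-+ (suc k) _ _)

⊛-scaleˡ : ∀ c (f h : Series) → (c · f) ⊛ h ≈ c · (f ⊛ h)
⊛-scaleˡ c f h k = trans (sumTo-cong (suc k) (λ i _ → ℤP.*-assoc c (f i) (h (k ∸ i)))) (sumTo-*ˡ (suc k) c _)

⊛-suc : ∀ (f g : Series) k → (f ⊛ g) (suc k) ≡ f 0 * g (suc k) + (tail f ⊛ g) k
⊛-suc f g k = sumTo-head (suc k) (λ i → f i * g (suc k ∸ i))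

⊛-assoc : ∀ (f g h : Series) → (f ⊛ g) ⊛ h ≈ f ⊛ (g ⊛ h)
⊛-assoc f g h zero = rearrange (f 0) (g 0) (h 0)
  where
  rearrange : ∀ a b c → + 0 + (+ 0 + a * b) * c ≡ + 0 + a * (+ 0 + b * c)
  rearrange = solve-∀
⊛-assoc f g h (suc k) = begin
  ((f ⊛ g) ⊛ h) (suc k)                                         ≡⟨ ⊛-suc (f ⊛ g) h k ⟩
  (f ⊛ g) 0 * h (suc k) + (tail (f ⊛ g) ⊛ h) k                  ≡⟨ cong (λ x → (f ⊛ g) 0 * h (suc k) + x) tail-part ⟩
  (f ⊛ g) 0 * h (suc k) + (f 0 * (tail g ⊛ h) k + (tail f ⊛ (g ⊛ h)) k)
                                                                ≡⟨ rearrange (f 0) (g 0) (h (suc k)) _ _ ⟩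
  f 0 * (g 0 * h (suc k) + (tail g ⊛ h) k) + (tail f ⊛ (g ⊛ h)) k
                                                                ≡⟨ cong (λ x → f 0 * x + (tail f ⊛ (g ⊛ h)) k) (sym (⊛-suc g h k)) ⟩
  f 0 * (g ⊛ h) (suc k) + (tail f ⊛ (g ⊛ h)) k                  ≡⟨ sym (⊛-suc f (g ⊛ h) k) ⟩
  (f ⊛ (g ⊛ h)) (suc k)                                         ∎
  where
  open ≡-Reasoning
  rearrange : ∀ a b c t r → (+ 0 + a * b) * c + (a * t + r) ≡ a * (b * c + t) + r
  rearrange = solve-∀
  -- tail (f g) = f_0 · tail g + (tail f) g, then the induction hypothesis.
  tail-part : (tail (f ⊛ g) ⊛ h) k ≡ f 0 * (tail g ⊛ h) k + (tail f ⊛ (g ⊛ h)) k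
  tail-part = begin
    (tail (f ⊛ g) ⊛ h) k                        ≡⟨ ⊛-congʳ h (⊛-suc f g) k ⟩
    (((f 0 · tail g) ⊞ (tail f ⊛ g)) ⊛ h) k     ≡⟨ ⊛-distribʳ (f 0 · tail g) (tail f ⊛ g) h k ⟩
    ((f 0 · tail g) ⊛ h) k + ((tail f ⊛ g) ⊛ h) k ≡⟨ cong₂ _+_ (⊛-scaleˡ (f 0) (tail g) h k) (⊛-assoc (tail f) g h k) ⟩
    f 0 * (tail g ⊛ h) k + (tail f ⊛ (g ⊛ h)) k  ∎

seriesMonoid : CommutativeMonoid 0ℓ 0ℓ
seriesMonoid = record
  { Carrier = Series ; _≈_ = _≈_ ; _∙_ = _⊛_ ; ε = one
  ; isCommutativeMonoid = record
    { isMonoid = record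
      { isSemigroup = record
        { isMagma = record
          { isEquivalence = record { refl = λ _ → refl ; sym = λ p k → sym (p k) ; trans = λ p q k → trans (p k) (q k) }
          ; ∙-cong = ⊛-cong }
        ; assoc = ⊛-assoc }
      ; identity = ⊛-identityˡ , ⊛-identityʳ }
    ; comm = ⊛-comm } }

open CommutativeMonoid seriesMonoid
  using () renaming (refl to ≈-refl; sym to ≈-sym; trans to ≈-trans; setoid to seriesSetoid)
open CommSemigroupProperties (CommutativeMonoid.commutativeSemigroup seriesMonoid) using (interchange)
open CommMonoidSolver seriesMonoid using (solve; _⊜_; _⊕_)

shiftN-cong : ∀ d {f g} → f ≈ g → shiftN d f ≈ shiftN d g
shiftN-cong zero    eq         = eq
shiftN-cong (suc d) eq zero    = refl
shiftN-cong (suc d) eq (suc k) = shiftN-cong d eq k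

qShift-⊛ : ∀ (f g : Series) → f ⊛ qShift g ≈ qShift (f ⊛ g)
qShift-⊛ f g zero    = trans (ℤP.+-identityˡ (f 0 * + 0)) (ℤP.*-zeroʳ (f 0))
qShift-⊛ f g (suc k) = begin
  sumTo (suc k) (λ i → f i * qShift g (suc k ∸ i)) + f (suc k) * qShift g (suc k ∸ suc k)
    ≡⟨ cong₂ _+_ (sumTo-cong (suc k) (λ i i≤k → cong (λ j → f i * qShift g j) (ℕP.+-∸-assoc 1 (ℕP.≤-pred i≤k))))
                 (trans (cong (λ j → f (suc k) * qShift g j) (ℕP.n∸n≡0 k)) (ℤP.*-zeroʳ (f (suc k)))) ⟩
  sumTo (suc k) (λ i → f i * g (k ∸ i)) + + 0
    ≡⟨ ℤP.+-identityʳ _ ⟩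
  sumTo (suc k) (λ i → f i * g (k ∸ i)) ∎
  where open ≡-Reasoning

shiftN-⊛ : ∀ d (f g : Series) → f ⊛ shiftN d g ≈ shiftN d (f ⊛ g)
shiftN-⊛ zero    f g = ≈-refl
shiftN-⊛ (suc d) f g = ≈-trans (qShift-⊛ f (shiftN d g)) (shiftN-cong 1 (shiftN-⊛ d f g))

shiftN-at : ∀ d g j → shiftN d g (d ℕ.+ j) ≡ g j
shiftN-at zero    g j = refl
shiftN-at (suc d) g j = shiftN-at d g j

shiftN-below : ∀ d g k → k ℕ.< d → shiftN d g k ≡ + 0
shiftN-below (suc d) g zero    _         = refl
shiftN-below (suc d) g (suc k) (s≤s k<d) = shiftN-below d g k k<d

oneMinusQ-top : ∀ d → d ≢ 0 → oneMinusQ d d ≡ -1ℤ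
oneMinusQ-top d d≢0 with d ℕ.≟ 0
... | yes d≡0 = ⊥-elim (d≢0 d≡0)
... | no _ with d ℕ.≟ d
...   | yes _ = refl
...   | no d≢d = ⊥-elim (d≢d refl)

oneMinusQ-off : ∀ d k → k ≢ 0 → k ≢ d → oneMinusQ d k ≡ + 0
oneMinusQ-off d k k≢0 k≢d with k ℕ.≟ 0
... | yes k≡0 = ⊥-elim (k≢0 k≡0)
... | no _ with k ℕ.≟ d
...   | yes k≡d = ⊥-elim (k≢d k≡d)
...   | no _    = refl

oneMinusQ-as-shift : ∀ d → oneMinusQ (suc d) ≈ one ⊞ (-1ℤ · shiftN (suc d) one)
oneMinusQ-as-shift d zero = refl
oneMinusQ-as-shift d (suc k) with k ℕ.≟ d
... | yes refl = trans (oneMinusQ-top (suc k) (λ ())) (cong (λ x → + 0 + -1ℤ * x) (sym (shiftN-one-at k)))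
  where
  shiftN-one-at : ∀ d → shiftN d one d ≡ + 1
  shiftN-one-at zero    = refl
  shiftN-one-at (suc d) = shiftN-one-at d
... | no k≢d = trans (oneMinusQ-off (suc d) (suc k) (λ ()) (k≢d ∘ ℕP.suc-injective))
                     (cong (λ x → + 0 + -1ℤ * x) (sym (shiftN-one-off d k k≢d)))
  where
  shiftN-one-off : ∀ d k → k ≢ d → shiftN d one k ≡ + 0
  shiftN-one-off zero    zero    k≢d = ⊥-elim (k≢d refl)
  shiftN-one-off zero    (suc k) k≢d = refl
  shiftN-one-off (suc d) zero    k≢d = refl
  shiftN-one-off (suc d) (suc k) k≢d = shiftN-one-off d k (k≢d ∘ cong suc)

geom-yes : ∀ d k → d ∣ k → geom d k ≡ + 1
geom-yes d k d∣k with d ∣? k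
... | yes _  = refl
... | no d∤k = ⊥-elim (d∤k d∣k)

geom-no : ∀ d k → ¬ d ∣ k → geom d k ≡ + 0
geom-no d k d∤k with d ∣? k
... | yes d∣k = ⊥-elim (d∤k d∣k)
... | no _    = refl

geom-periodic : ∀ d j → geom d (d ℕ.+ j) ≡ geom d j
geom-periodic d j with d ∣? j
... | yes d∣j = geom-yes d (d ℕ.+ j) (∣m∣n⇒∣m+n n∣n d∣j)
... | no d∤j  = geom-no d (d ℕ.+ j) (λ d∣d+j → d∤j (∣m+n∣m⇒∣n d∣d+j n∣n))

-- (1 - q^D) · 1/(1 - q^D) = 1: after expanding 1 - q^D the coefficient of
-- q^k is geom D k - geom D (k - D), which telescopes by periodicity.
oneMinusQ-⊛-geom : ∀ D .{{_ : NonZero D}} → oneMinusQ D ⊛ geom D ≈ one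
oneMinusQ-⊛-geom D@(suc d) k = begin
  (oneMinusQ D ⊛ G) k                        ≡⟨ ⊛-congʳ G (oneMinusQ-as-shift d) k ⟩
  ((one ⊞ (-1ℤ · shiftN D one)) ⊛ G) k     ≡⟨ ⊛-distribʳ one (-1ℤ · shiftN D one) G k ⟩
  (one ⊛ G) k + ((-1ℤ · shiftN D one) ⊛ G) k ≡⟨ cong₂ _+_ (⊛-identityˡ G k) (⊛-scaleˡ (-1ℤ) (shiftN D one) G k) ⟩
  G k + -1ℤ * (shiftN D one ⊛ G) k         ≡⟨ cong (λ x → G k + -1ℤ * x) shifted ⟩
  G k + -1ℤ * shiftN D G k                 ≡⟨ telescope k ⟩
  one k                                      ∎
  where
  open ≡-Reasoning
  G = geom D
  shifted : (shiftN D one ⊛ G) k ≡ shiftN D G k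
  shifted = trans (⊛-comm (shiftN D one) G k) (trans (shiftN-⊛ D G one k) (shiftN-cong D (⊛-identityʳ G) k))
  cancel : ∀ x → x + -1ℤ * x ≡ + 0
  cancel = solve-∀
  telescope : ∀ k → G k + -1ℤ * shiftN D G k ≡ one k
  telescope zero = refl
  telescope (suc k) with suc k ℕ.<? D
  ... | yes k<D = cong₂ (λ u v → u + -1ℤ * v) (geom-no D (suc k) (λ D∣k → ℕP.<⇒≱ k<D (∣⇒≤ D∣k)))
                                              (shiftN-below D G (suc k) k<D)
  ... | no k≮D  = begin
    G (suc k) + -1ℤ * shiftN D G (suc k)         ≡⟨ cong (λ i → G i + -1ℤ * shiftN D G i) (sym D+j≡k) ⟩
    G (D ℕ.+ j) + -1ℤ * shiftN D G (D ℕ.+ j)     ≡⟨ cong₂ (λ u v → u + -1ℤ * v) (geom-periodic D j) (shiftN-at D G j) ⟩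
    G j + -1ℤ * G j                              ≡⟨ cancel (G j) ⟩
    + 0                                            ∎
    where
    j = suc k ∸ D
    D+j≡k : D ℕ.+ j ≡ suc k
    D+j≡k = ℕP.m+[n∸m]≡n (ℕP.≮⇒≥ k≮D)

pow-cong : ∀ {f g} n → f ≈ g → pow f n ≈ pow g n
pow-cong zero    eq = ≈-refl
pow-cong (suc n) eq = ⊛-cong eq (pow-cong n eq)

pow-inverse : ∀ {f g} n → f ⊛ g ≈ one → pow f n ⊛ pow g n ≈ one
pow-inverse zero    fg≈1 = ⊛-identityˡ one
pow-inverse {f} {g} (suc n) fg≈1 =
  ≈-trans (interchange f (pow f n) g (pow g n)) (≈-trans (⊛-cong fg≈1 (pow-inverse n fg≈1)) (⊛-identityˡ one))

factor-inverse : ∀ D .{{_ : NonZero D}} e → factor D e ⊛ factor D (- e) ≈ one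
factor-inverse D (+ zero)  = ⊛-identityˡ one
factor-inverse D (+ suc n) = pow-inverse {oneMinusQ D} {geom D} (suc n) (oneMinusQ-⊛-geom D)
factor-inverse D -[1+ n ]  = ≈-trans (⊛-comm (factor D -[1+ n ]) (factor D (+ suc n)))
                                     (pow-inverse {oneMinusQ D} {geom D} (suc n) (oneMinusQ-⊛-geom D))

-- A factor (1 - q^D)^e only affects
-- coefficients of order ≥ D, so the coefficient of q^i in the product over
-- j ≤ N is the same for every N ≥ i; in particular it equals that of eta.

AgreesWithOneBelow : ℕ → Series → Set
AgreesWithOneBelow D f = ∀ j → j ℕ.< D → f j ≡ one j

agrees-⊛ : ∀ D {f g} → AgreesWithOneBelow D f → AgreesWithOneBelow D g → AgreesWithOneBelow D (f ⊛ g)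
agrees-⊛ D f≈1 g≈1 j j<D =
  trans (⊛-cong-upTo j (λ i i≤j → f≈1 i (ℕP.≤-<-trans i≤j j<D)) (λ i i≤j → g≈1 i (ℕP.≤-<-trans i≤j j<D)))
        (⊛-identityˡ one j)

agrees-pow : ∀ D {f} n → AgreesWithOneBelow D f → AgreesWithOneBelow D (pow f n)
agrees-pow D zero    f≈1 j _ = refl
agrees-pow D (suc n) f≈1     = agrees-⊛ D f≈1 (agrees-pow D n f≈1)

agrees-factor : ∀ D .{{_ : NonZero D}} e → AgreesWithOneBelow D (factor D e)
agrees-factor D (+ n)    = agrees-pow D n oneMinusQ-agrees
  where
  oneMinusQ-agrees : AgreesWithOneBelow D (oneMinusQ D)
  oneMinusQ-agrees zero    _   = refl
  oneMinusQ-agrees (suc j) j<D = oneMinusQ-off D (suc j) (λ ()) (λ j≡D → ℕP.<-irrefl j≡D j<D)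
agrees-factor D -[1+ n ] = agrees-pow D (suc n) geom-agrees
  where
  geom-agrees : AgreesWithOneBelow D (geom D)
  geom-agrees zero    _   = geom-yes D 0 (D ∣0)
  geom-agrees (suc j) j<D = geom-no D (suc j) (λ D∣j → ℕP.<⇒≱ j<D (∣⇒≤ D∣j))

etaTrunc-step : ∀ A .{{_ : NonZero A}} e N i → i ℕ.< A ℕ.* suc N → etaTrunc A e (suc N) i ≡ etaTrunc A e N i
etaTrunc-step A e N i i<D =
  trans (⊛-cong-upTo i {f = etaTrunc A e N} (λ _ _ → refl) (λ j j≤i → factor≈1 j (ℕP.≤-<-trans j≤i i<D)))
        (⊛-identityʳ (etaTrunc A e N) i)
  where
  factor≈1 : AgreesWithOneBelow (A ℕ.* suc N) (factor (A ℕ.* suc N) e)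
  factor≈1 = agrees-factor (A ℕ.* suc N) {{ℕP.m*n≢0 A (suc N)}} e

etaTrunc-eta : ∀ A .{{_ : NonZero A}} e N i → i ℕ.≤ N → etaTrunc A e N i ≡ eta A e i
etaTrunc-eta A e N i i≤N = trans (cong (λ M → etaTrunc A e M i) (sym (ℕP.m∸n+n≡m i≤N))) (stable (N ∸ i))
  where
  stable : ∀ d → etaTrunc A e (d ℕ.+ i) i ≡ etaTrunc A e i i
  stable zero    = refl
  stable (suc d) = trans (etaTrunc-step A e (d ℕ.+ i) i i<A*[1+d+i]) (stable d)
    where
    i<A*[1+d+i] : i ℕ.< A ℕ.* suc (d ℕ.+ i)
    i<A*[1+d+i] = ℕP.<-≤-trans (s≤s (ℕP.m≤n+m i d)) (ℕP.m≤n*m (suc (d ℕ.+ i)) A)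

eta-inverse : ∀ A .{{_ : NonZero A}} e → eta A e ⊛ eta A (- e) ≈ one
eta-inverse A e k =
  trans (⊛-cong-upTo k (λ i i≤k → sym (etaTrunc-eta A e k i i≤k)) (λ i i≤k → sym (etaTrunc-eta A (- e) k i i≤k)))
        (truncations-inverse k k)
  where
  truncations-inverse : ∀ N → etaTrunc A e N ⊛ etaTrunc A (- e) N ≈ one
  truncations-inverse zero    = ⊛-identityˡ one
  truncations-inverse (suc N) =
    ≈-trans (interchange (etaTrunc A e N) (factor (A ℕ.* suc N) e) (etaTrunc A (- e) N) (factor (A ℕ.* suc N) (- e)))
            (≈-trans (⊛-cong (truncations-inverse N) (factor-inverse (A ℕ.* suc N) {{ℕP.m*n≢0 A (suc N)}} e))
                     (⊛-identityˡ one))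

-- The substitution q ↦ q^n,  dilate n f = f(q^n).  It is a monoid
-- homomorphism, it sends the building blocks 1 - q^D and 1/(1 - q^D) of
-- eta to those for D n, and U_n (f(q^n) g) = f · U_n g.

dilate : ℕ → Series → Series
dilate n f k with n ∣? k
... | yes (divides m _) = f m
... | no _              = + 0

U : ℕ → Series → Series
U n f m = f (n ℕ.* m)

module _ (n : ℕ) .{{_ : NonZero n}} where

  by-residue : ∀ {F G : Series} → (∀ m → F (m ℕ.* n) ≡ G (m ℕ.* n)) →
               (∀ m r → suc r ℕ.< n → F (m ℕ.* n ℕ.+ suc r) ≡ G (m ℕ.* n ℕ.+ suc r)) → F ≈ G
  by-residue {F} {G} multiples residues k with k % n | m%n<n k n | m≡m%n+[m/n]*n k n
  ... | zero  | _   | k≡ = trans (cong F k≡) (trans (multiples (k / n)) (cong G (sym k≡)))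
  ... | suc r | r<n | k≡ = trans (cong F k≡′) (trans (residues (k / n) r r<n) (cong G (sym k≡′)))
    where
    k≡′ : k ≡ k / n ℕ.* n ℕ.+ suc r
    k≡′ = trans k≡ (ℕP.+-comm (suc r) (k / n ℕ.* n))

  not-multiple : ∀ m r → suc r ℕ.< n → ¬ n ∣ m ℕ.* n ℕ.+ suc r
  not-multiple m r r<n n∣k = ℕP.<⇒≱ r<n (∣⇒≤ (∣m+n∣m⇒∣n n∣k (n∣m*n m)))

  dilate-multiple : ∀ f m → dilate n f (m ℕ.* n) ≡ f m
  dilate-multiple f m with n ∣? m ℕ.* n
  ... | yes (divides m′ eq) = cong f (ℕP.*-cancelʳ-≡ m′ m n (sym eq))
  ... | no n∤mn             = ⊥-elim (n∤mn (n∣m*n m))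

  dilate-off : ∀ f k → ¬ n ∣ k → dilate n f k ≡ + 0
  dilate-off f k n∤k with n ∣? k
  ... | yes n∣k = ⊥-elim (n∤k n∣k)
  ... | no _    = refl

  dilate-periodic : ∀ f j → dilate n f (n ℕ.+ j) ≡ dilate n (tail f) j
  dilate-periodic f j = by-cases (n ∣? j)
    where
    by-cases : Dec (n ∣ j) → dilate n f (n ℕ.+ j) ≡ dilate n (tail f) j
    by-cases (yes (divides m j≡mn)) = begin
      dilate n f (n ℕ.+ j)      ≡⟨ cong (λ i → dilate n f (n ℕ.+ i)) j≡mn ⟩
      dilate n f (suc m ℕ.* n)  ≡⟨ dilate-multiple f (suc m) ⟩
      f (suc m)                 ≡⟨ sym (dilate-multiple (tail f) m) ⟩
      dilate n (tail f) (m ℕ.* n) ≡⟨ cong (dilate n (tail f)) (sym j≡mn) ⟩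
      dilate n (tail f) j       ∎
      where open ≡-Reasoning
    by-cases (no n∤j) = trans (dilate-off f (n ℕ.+ j) (λ n∣n+j → n∤j (∣m+n∣m⇒∣n n∣n+j n∣n)))
                              (sym (dilate-off (tail f) j n∤j))

  dilate-split : ∀ f → dilate n f ≈ (f 0 · one) ⊞ shiftN n (dilate n (tail f))
  dilate-split f k with k ℕ.<? n
  dilate-split f zero    | yes 0<n = sym (trans (cong₂ _+_ (ℤP.*-identityʳ (f 0)) (shiftN-below n _ 0 0<n))
                                               (trans (ℤP.+-identityʳ (f 0)) (sym (dilate-multiple f 0))))
  dilate-split f (suc k) | yes k<n = trans (dilate-off f (suc k) (λ n∣k → ℕP.<⇒≱ k<n (∣⇒≤ n∣k)))
                                           (sym (cong₂ _+_ (ℤP.*-zeroʳ (f 0)) (shiftN-below n _ (suc k) k<n)))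
  dilate-split f k       | no k≮n  = begin
    dilate n f k                                          ≡⟨ cong (dilate n f) (sym n+j≡k) ⟩
    dilate n f (n ℕ.+ j)                                  ≡⟨ dilate-periodic f j ⟩
    dilate n (tail f) j                                   ≡⟨ sym (shiftN-at n (dilate n (tail f)) j) ⟩
    shiftN n (dilate n (tail f)) (n ℕ.+ j)                ≡⟨ sym (ℤP.+-identityˡ _) ⟩
    + 0 + shiftN n (dilate n (tail f)) (n ℕ.+ j)          ≡⟨ cong₂ (λ x i → x + shiftN n (dilate n (tail f)) i) (sym f0·0) n+j≡k ⟩
    f 0 * one k + shiftN n (dilate n (tail f)) k          ∎
    where
    open ≡-Reasoning
    j = k ∸ n
    n+j≡k : n ℕ.+ j ≡ k
    n+j≡k = ℕP.m+[n∸m]≡n (ℕP.≮⇒≥ k≮n)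
    f0·0 : f 0 * one k ≡ + 0
    f0·0 = trans (cong (f 0 *_) (one-suc k (ℕP.<-≤-trans (ℕ.>-nonZero⁻¹ n) (ℕP.≮⇒≥ k≮n)))) (ℤP.*-zeroʳ (f 0))

  split-⊛ : ∀ f g k → (dilate n f ⊛ g) k ≡ f 0 * g k + shiftN n (dilate n (tail f) ⊛ g) k
  split-⊛ f g k = begin
    (dilate n f ⊛ g) k                                   ≡⟨ ⊛-congʳ g (dilate-split f) k ⟩
    (((f 0 · one) ⊞ shiftN n f′) ⊛ g) k                  ≡⟨ ⊛-distribʳ (f 0 · one) (shiftN n f′) g k ⟩
    ((f 0 · one) ⊛ g) k + (shiftN n f′ ⊛ g) k            ≡⟨ cong₂ _+_ constant-part shifted-part ⟩
    f 0 * g k + shiftN n (f′ ⊛ g) k                      ∎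
    where
    open ≡-Reasoning
    f′ = dilate n (tail f)
    constant-part : ((f 0 · one) ⊛ g) k ≡ f 0 * g k
    constant-part = trans (⊛-scaleˡ (f 0) one g k) (cong (f 0 *_) (⊛-identityˡ g k))
    shifted-part : (shiftN n f′ ⊛ g) k ≡ shiftN n (f′ ⊛ g) k
    shifted-part = trans (⊛-comm (shiftN n f′) g k) (trans (shiftN-⊛ n g f′ k) (shiftN-cong n (⊛-comm g f′) k))

  dilate-⊛ : ∀ f g m r → r ℕ.< n → (dilate n f ⊛ g) (m ℕ.* n ℕ.+ r) ≡ (f ⊛ (λ j → g (j ℕ.* n ℕ.+ r))) m
  dilate-⊛ f g zero r r<n = begin
    (dilate n f ⊛ g) r                                 ≡⟨ split-⊛ f g r ⟩
    f 0 * g r + shiftN n (dilate n (tail f) ⊛ g) r     ≡⟨ cong (λ y → f 0 * g r + y) (shiftN-below n _ r r<n) ⟩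
    f 0 * g r + + 0                                    ≡⟨ trans (ℤP.+-identityʳ (f 0 * g r)) (sym (ℤP.+-identityˡ (f 0 * g r))) ⟩
    (f ⊛ (λ j → g (j ℕ.* n ℕ.+ r))) 0                  ∎
    where open ≡-Reasoning
  dilate-⊛ f g (suc m) r r<n = begin
    (dilate n f ⊛ g) (suc m ℕ.* n ℕ.+ r)                            ≡⟨ cong (dilate n f ⊛ g) reassoc ⟩
    (dilate n f ⊛ g) (n ℕ.+ X)                                      ≡⟨ split-⊛ f g (n ℕ.+ X) ⟩
    f 0 * g (n ℕ.+ X) + shiftN n (dilate n (tail f) ⊛ g) (n ℕ.+ X)  ≡⟨ cong₂ (λ i y → f 0 * g i + y) (sym reassoc)
                                                                              (shiftN-at n _ X) ⟩
    f 0 * h (suc m) + (dilate n (tail f) ⊛ g) X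
                                                  ≡⟨ cong (λ y → f 0 * h (suc m) + y) (dilate-⊛ (tail f) g m r r<n) ⟩
    f 0 * h (suc m) + (tail f ⊛ h) m                                ≡⟨ sym (⊛-suc f h m) ⟩
    (f ⊛ h) (suc m)                                                 ∎
    where
    open ≡-Reasoning
    X = m ℕ.* n ℕ.+ r
    h : Series
    h j = g (j ℕ.* n ℕ.+ r)
    reassoc : suc m ℕ.* n ℕ.+ r ≡ n ℕ.+ X
    reassoc = ℕP.+-assoc n (m ℕ.* n) r

  U-dilate : ∀ f g → U n (dilate n f ⊛ g) ≈ f ⊛ U n g
  U-dilate f g m = begin
    (dilate n f ⊛ g) (n ℕ.* m)                ≡⟨ cong (dilate n f ⊛ g) (sym mn+0) ⟩
    (dilate n f ⊛ g) (m ℕ.* n ℕ.+ 0)          ≡⟨ dilate-⊛ f g m 0 (ℕ.>-nonZero⁻¹ n) ⟩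
    (f ⊛ (λ j → g (j ℕ.* n ℕ.+ 0))) m         ≡⟨ ⊛-cong-upTo m {f = f} (λ _ _ → refl) (λ j _ → cong g (jn+0 j)) ⟩
    (f ⊛ U n g) m                             ∎
    where
    open ≡-Reasoning
    mn+0 : m ℕ.* n ℕ.+ 0 ≡ n ℕ.* m
    mn+0 = trans (ℕP.+-identityʳ (m ℕ.* n)) (ℕP.*-comm m n)
    jn+0 : ∀ j → j ℕ.* n ℕ.+ 0 ≡ n ℕ.* j
    jn+0 j = trans (ℕP.+-identityʳ (j ℕ.* n)) (ℕP.*-comm j n)

  dilate-⊛-dilate : ∀ f g → dilate n f ⊛ dilate n g ≈ dilate n (f ⊛ g)
  dilate-⊛-dilate f g = by-residue multiples residues
    where
    multiples : ∀ m → (dilate n f ⊛ dilate n g) (m ℕ.* n) ≡ dilate n (f ⊛ g) (m ℕ.* n)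
    multiples m = begin
      (dilate n f ⊛ dilate n g) (m ℕ.* n)        ≡⟨ cong (dilate n f ⊛ dilate n g) (sym (ℕP.+-identityʳ (m ℕ.* n))) ⟩
      (dilate n f ⊛ dilate n g) (m ℕ.* n ℕ.+ 0)  ≡⟨ dilate-⊛ f (dilate n g) m 0 (ℕ.>-nonZero⁻¹ n) ⟩
      (f ⊛ (λ j → dilate n g (j ℕ.* n ℕ.+ 0))) m ≡⟨ ⊛-cong-upTo m {f = f} (λ _ _ → refl) (λ j _ → on-multiple j) ⟩
      (f ⊛ g) m                                  ≡⟨ sym (dilate-multiple (f ⊛ g) m) ⟩
      dilate n (f ⊛ g) (m ℕ.* n)                 ∎
      where
      open ≡-Reasoning
      on-multiple : ∀ j → dilate n g (j ℕ.* n ℕ.+ 0) ≡ g j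
      on-multiple j = trans (cong (dilate n g) (ℕP.+-identityʳ (j ℕ.* n))) (dilate-multiple g j)
    residues : ∀ m r → suc r ℕ.< n → (dilate n f ⊛ dilate n g) (m ℕ.* n ℕ.+ suc r) ≡ dilate n (f ⊛ g) (m ℕ.* n ℕ.+ suc r)
    residues m r r<n = begin
      (dilate n f ⊛ dilate n g) (m ℕ.* n ℕ.+ suc r)          ≡⟨ dilate-⊛ f (dilate n g) m (suc r) r<n ⟩
      (f ⊛ (λ j → dilate n g (j ℕ.* n ℕ.+ suc r))) m        ≡⟨ sumTo-zero (suc m) (λ i _ → vanish i) ⟩
      + 0                                                   ≡⟨ sym (dilate-off (f ⊛ g) _ (not-multiple m r r<n)) ⟩
      dilate n (f ⊛ g) (m ℕ.* n ℕ.+ suc r)                  ∎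
      where
      open ≡-Reasoning
      vanish : ∀ i → f i * dilate n g ((m ∸ i) ℕ.* n ℕ.+ suc r) ≡ + 0
      vanish i = trans (cong (f i *_) (dilate-off g _ (not-multiple (m ∸ i) r r<n))) (ℤP.*-zeroʳ (f i))

  dilate-one : dilate n one ≈ one
  dilate-one = by-residue multiples residues
    where
    multiples : ∀ m → dilate n one (m ℕ.* n) ≡ one (m ℕ.* n)
    multiples zero    = dilate-multiple one 0
    multiples (suc m) = trans (dilate-multiple one (suc m))
                              (sym (one-suc (suc m ℕ.* n) (ℕ.>-nonZero⁻¹ (suc m ℕ.* n) {{ℕP.m*n≢0 (suc m) n}})))
    residues : ∀ m r → suc r ℕ.< n → dilate n one (m ℕ.* n ℕ.+ suc r) ≡ one (m ℕ.* n ℕ.+ suc r)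
    residues m r r<n = trans (dilate-off one _ (not-multiple m r r<n))
                             (sym (one-suc _ (ℕP.<-≤-trans (s≤s z≤n) (ℕP.m≤n+m (suc r) (m ℕ.* n)))))

  dilate-pow : ∀ f k → dilate n (pow f k) ≈ pow (dilate n f) k
  dilate-pow f zero    = dilate-one
  dilate-pow f (suc k) = ≈-trans (≈-sym (dilate-⊛-dilate f (pow f k))) (⊛-congˡ (dilate n f) (dilate-pow f k))

  dilate-oneMinusQ : ∀ D .{{_ : NonZero D}} → dilate n (oneMinusQ D) ≈ oneMinusQ (D ℕ.* n)
  dilate-oneMinusQ D = by-residue multiples residues
    where
    multiples : ∀ m → dilate n (oneMinusQ D) (m ℕ.* n) ≡ oneMinusQ (D ℕ.* n) (m ℕ.* n)
    multiples m with m ℕ.≟ 0 | m ℕ.≟ D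
    ... | yes refl | _        = dilate-multiple (oneMinusQ D) 0
    ... | no _     | yes refl = trans (dilate-multiple (oneMinusQ D) D)
                                      (trans (oneMinusQ-top D (ℕ.≢-nonZero⁻¹ D))
                                             (sym (oneMinusQ-top (D ℕ.* n) (ℕ.≢-nonZero⁻¹ (D ℕ.* n) {{ℕP.m*n≢0 D n}}))))
    ... | no m≢0   | no m≢D   = trans (dilate-multiple (oneMinusQ D) m)
                                      (trans (oneMinusQ-off D m m≢0 m≢D)
                                             (sym (oneMinusQ-off (D ℕ.* n) (m ℕ.* n)
                                                    (m≢0 ∘ ℕP.*-cancelʳ-≡ m 0 n) (m≢D ∘ ℕP.*-cancelʳ-≡ m D n))))
    residues : ∀ m r → suc r ℕ.< n → dilate n (oneMinusQ D) (m ℕ.* n ℕ.+ suc r) ≡ oneMinusQ (D ℕ.* n) (m ℕ.* n ℕ.+ suc r)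
    residues m r r<n = trans (dilate-off (oneMinusQ D) _ (not-multiple m r r<n))
                             (sym (oneMinusQ-off (D ℕ.* n) _
                                    (λ k≡0 → not-multiple m r r<n (subst (n ∣_) (sym k≡0) (n ∣0)))
                                    (λ k≡Dn → not-multiple m r r<n (subst (n ∣_) (sym k≡Dn) (n∣m*n D)))))

  dilate-geom : ∀ D → dilate n (geom D) ≈ geom (D ℕ.* n)
  dilate-geom D = by-residue multiples residues
    where
    multiples : ∀ m → dilate n (geom D) (m ℕ.* n) ≡ geom (D ℕ.* n) (m ℕ.* n)
    multiples m with D ∣? m
    ... | yes D∣m = trans (dilate-multiple (geom D) m)
                          (trans (geom-yes D m D∣m) (sym (geom-yes (D ℕ.* n) (m ℕ.* n) (*-monoˡ-∣ n D∣m))))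
    ... | no D∤m  = trans (dilate-multiple (geom D) m)
                          (trans (geom-no D m D∤m) (sym (geom-no (D ℕ.* n) (m ℕ.* n) (D∤m ∘ *-cancelʳ-∣ n))))
    residues : ∀ m r → suc r ℕ.< n → dilate n (geom D) (m ℕ.* n ℕ.+ suc r) ≡ geom (D ℕ.* n) (m ℕ.* n ℕ.+ suc r)
    residues m r r<n = trans (dilate-off (geom D) _ (not-multiple m r r<n))
                             (sym (geom-no (D ℕ.* n) _ (not-multiple m r r<n ∘ m*n∣⇒n∣ D n)))

  dilate-factor : ∀ D .{{_ : NonZero D}} e → dilate n (factor D e) ≈ factor (D ℕ.* n) e
  dilate-factor D (+ k)    = ≈-trans (dilate-pow (oneMinusQ D) k) (pow-cong k (dilate-oneMinusQ D))
  dilate-factor D -[1+ k ] = ≈-trans (dilate-pow (geom D) (suc k)) (pow-cong (suc k) (dilate-geom D))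

  dilate-etaTrunc : ∀ A .{{_ : NonZero A}} e N → dilate n (etaTrunc A e N) ≈ etaTrunc (A ℕ.* n) e N
  dilate-etaTrunc A e zero    = dilate-one
  dilate-etaTrunc A e (suc N) =
    ≈-trans (≈-sym (dilate-⊛-dilate (etaTrunc A e N) (factor (A ℕ.* suc N) e)))
            (⊛-cong (dilate-etaTrunc A e N) (λ k → trans (dilate-factor (A ℕ.* suc N) {{ℕP.m*n≢0 A (suc N)}} e k)
                                                         (cong (λ D → factor D e k) reorder)))
    where
    reorder : A ℕ.* suc N ℕ.* n ≡ A ℕ.* n ℕ.* suc N
    reorder = trans (ℕP.*-assoc A (suc N) n) (trans (cong (A ℕ.*_) (ℕP.*-comm (suc N) n)) (sym (ℕP.*-assoc A n (suc N))))

  dilate-cong-upTo : ∀ {f g} k → (∀ i → i ℕ.≤ k → f i ≡ g i) → dilate n f k ≡ dilate n g k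
  dilate-cong-upTo {f} {g} k f≡g = by-cases (n ∣? k)
    where
    by-cases : Dec (n ∣ k) → dilate n f k ≡ dilate n g k
    by-cases (yes (divides m k≡mn)) = begin
      dilate n f k        ≡⟨ cong (dilate n f) k≡mn ⟩
      dilate n f (m ℕ.* n) ≡⟨ dilate-multiple f m ⟩
      f m                 ≡⟨ f≡g m (subst (m ℕ.≤_) (sym k≡mn) (ℕP.m≤m*n m n)) ⟩
      g m                 ≡⟨ sym (dilate-multiple g m) ⟩
      dilate n g (m ℕ.* n) ≡⟨ cong (dilate n g) (sym k≡mn) ⟩
      dilate n g k        ∎
      where open ≡-Reasoning
    by-cases (no n∤k) = trans (dilate-off f k n∤k) (sym (dilate-off g k n∤k))

  dilate-eta : ∀ A .{{_ : NonZero A}} e → dilate n (eta A e) ≈ eta (A ℕ.* n) e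
  dilate-eta A e k = trans (dilate-cong-upTo k (λ i i≤k → sym (etaTrunc-eta A e k i i≤k)))
                           (dilate-etaTrunc A e k k)

U-cong : ∀ n {f g} → f ≈ g → U n f ≈ U n g
U-cong n f≈g m = f≈g (n ℕ.* m)

U₅-qShift : ∀ c → U 5 (qShift c) ≈ qShift (λ j → c (5 ℕ.* j ℕ.+ 4))
U₅-qShift c zero    = refl
U₅-qShift c (suc j) = cong c (five-suc j)
  where
  five-suc : ∀ j → j ℕ.+ 4 ℕ.* suc j ≡ 5 ℕ.* j ℕ.+ 4
  five-suc = ℕSolver.solve-∀

-- The eta quotient  Q_a = (q^a;q^a)^3 (q^{4a};q^{4a})^2 / (q^{2a};q^{2a})^5.
-- Q 5 is the prefactor of L_{2n-1}, Q 1 that of L_{2n}, and A = q a(q) Q 25.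
Q : ℕ → Series
Q a = eta a (+ 3) ⊛ eta (4 ℕ.* a) (+ 2) ⊛ eta (2 ℕ.* a) (- (+ 5))

dilate-Q : ∀ n .{{_ : NonZero n}} a .{{_ : NonZero a}} → dilate n (Q a) ≈ Q (a ℕ.* n)
dilate-Q n a = begin
  dilate n (E₁ ⊛ E₄ ⊛ E₂)                  ≈⟨ ≈-sym (dilate-⊛-dilate n (E₁ ⊛ E₄) E₂) ⟩
  dilate n (E₁ ⊛ E₄) ⊛ dilate n E₂         ≈⟨ ⊛-congʳ (dilate n E₂) (≈-sym (dilate-⊛-dilate n E₁ E₄)) ⟩
  dilate n E₁ ⊛ dilate n E₄ ⊛ dilate n E₂  ≈⟨ ⊛-cong (⊛-cong (dilate-eta n a (+ 3)) (scaled 4 (+ 2))) (scaled 2 (- (+ 5))) ⟩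
  Q (a ℕ.* n)                              ∎
  where
  open SetoidReasoning seriesSetoid
  E₁ = eta a (+ 3)
  E₄ = eta (4 ℕ.* a) (+ 2)
  E₂ = eta (2 ℕ.* a) (- (+ 5))
  scaled : ∀ c .{{_ : NonZero c}} e → dilate n (eta (c ℕ.* a) e) ≈ eta (c ℕ.* (a ℕ.* n)) e
  scaled c e k = trans (dilate-eta n (c ℕ.* a) {{ℕP.m*n≢0 c a}} e k) (cong (λ A → eta A e k) (ℕP.*-assoc c a n))

aGF-⊛-Q₁ : aGF ⊛ Q 1 ≈ one
aGF-⊛-Q₁ = begin
  aGF ⊛ Q 1                                  ≈⟨ solve 6 (λ a b c d e f → ((a ⊕ b) ⊕ c) ⊕ ((d ⊕ e) ⊕ f)
                                                                      ⊜ (a ⊕ f) ⊕ ((d ⊕ b) ⊕ (e ⊕ c)))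
                                                     ≈-refl (eta 2 (+ 5)) (eta 1 (- (+ 3))) (eta 4 (- (+ 2)))
                                                            (eta 1 (+ 3)) (eta 4 (+ 2)) (eta 2 (- (+ 5))) ⟩
  (eta 2 (+ 5) ⊛ eta 2 (- (+ 5))) ⊛ ((eta 1 (+ 3) ⊛ eta 1 (- (+ 3))) ⊛ (eta 4 (+ 2) ⊛ eta 4 (- (+ 2))))
                                             ≈⟨ ⊛-cong (eta-inverse 2 (+ 5)) (⊛-cong (eta-inverse 1 (+ 3)) (eta-inverse 4 (+ 2))) ⟩
  one ⊛ (one ⊛ one)                          ≈⟨ ≈-trans (⊛-identityˡ (one ⊛ one)) (⊛-identityˡ one) ⟩
  one                                        ∎
  where open SetoidReasoning seriesSetoid

oddCoefficients evenCoefficients : ℕ → ℕ → ℤ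
oddCoefficients  n m = a (5 ^ (2 ℕ.* n ∸ 1) ℕ.* m ℕ.+ λodd n)
evenCoefficients n m = a (5 ^ (2 ℕ.* n) ℕ.* m ℕ.+ λeven n)

-- If  s P · 24 + (t P + 1) = u (5 P) + 1  then
--   P (5 j + s) + (t P + 1)/24 = 5 P j + (u (5 P) + 1)/24.
-- This is how the offsets λ move along the residue class s mod 5.
offset-step : ∀ P j s t u → s ℕ.* P ℕ.* 24 ℕ.+ (t ℕ.* P ℕ.+ 1) ≡ u ℕ.* (5 ℕ.* P) ℕ.+ 1 →
              P ℕ.* (5 ℕ.* j ℕ.+ s) ℕ.+ (t ℕ.* P ℕ.+ 1) / 24 ≡ 5 ℕ.* P ℕ.* j ℕ.+ (u ℕ.* (5 ℕ.* P) ℕ.+ 1) / 24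
offset-step P j s t u hyp = begin
  P ℕ.* (5 ℕ.* j ℕ.+ s) ℕ.+ X / 24             ≡⟨ distribute P j s (X / 24) ⟩
  5 ℕ.* P ℕ.* j ℕ.+ (s ℕ.* P ℕ.+ X / 24)       ≡⟨ cong (5 ℕ.* P ℕ.* j ℕ.+_) (sym absorb) ⟩
  5 ℕ.* P ℕ.* j ℕ.+ (s ℕ.* P ℕ.* 24 ℕ.+ X) / 24 ≡⟨ cong (λ Y → 5 ℕ.* P ℕ.* j ℕ.+ Y / 24) hyp ⟩
  5 ℕ.* P ℕ.* j ℕ.+ (u ℕ.* (5 ℕ.* P) ℕ.+ 1) / 24 ∎
  where
  open ≡-Reasoning
  X = t ℕ.* P ℕ.+ 1
  distribute : ∀ P j s Y → P ℕ.* (5 ℕ.* j ℕ.+ s) ℕ.+ Y ≡ 5 ℕ.* P ℕ.* j ℕ.+ (s ℕ.* P ℕ.+ Y)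
  distribute = ℕSolver.solve-∀
  absorb : (s ℕ.* P ℕ.* 24 ℕ.+ X) / 24 ≡ s ℕ.* P ℕ.+ X / 24
  absorb = trans (+-distrib-/-∣ˡ X (divides (s ℕ.* P) refl)) (cong (ℕ._+ X / 24) (m*n/n≡m (s ℕ.* P) 24))

power-odd : ∀ m → 5 ^ (2 ℕ.* suc m ∸ 1) ≡ 5 ℕ.* 5 ^ (2 ℕ.* m)
power-odd m = cong (λ e → 5 ^ (e ∸ 1)) (ℕP.*-suc 2 m)

power-even : ∀ m → 5 ^ (2 ℕ.* suc m) ≡ 5 ℕ.* 5 ^ (2 ℕ.* suc m ∸ 1)
power-even m = trans (cong (5 ^_) (ℕP.*-suc 2 m)) (cong (5 ℕ.*_) (sym (power-odd m)))

evenCoefficients-residue-3 : ∀ k j → evenCoefficients (suc k) (5 ℕ.* j ℕ.+ 3) ≡ oddCoefficients (suc (suc k)) j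
evenCoefficients-residue-3 k j = cong a (trans (offset-step P j 3 23 19 (arith P))
                                               (cong (λ Z → Z ℕ.* j ℕ.+ (19 ℕ.* Z ℕ.+ 1) / 24) (sym (power-odd (suc k)))))
  where
  P = 5 ^ (2 ℕ.* suc k)
  arith : ∀ P → 3 ℕ.* P ℕ.* 24 ℕ.+ (23 ℕ.* P ℕ.+ 1) ≡ 19 ℕ.* (5 ℕ.* P) ℕ.+ 1
  arith = ℕSolver.solve-∀

oddCoefficients-residue-4 : ∀ k j → oddCoefficients (suc k) (5 ℕ.* j ℕ.+ 4) ≡ evenCoefficients (suc k) j
oddCoefficients-residue-4 k j = cong a (trans (offset-step P j 4 19 23 (arith P))
                                              (cong (λ Z → Z ℕ.* j ℕ.+ (23 ℕ.* Z ℕ.+ 1) / 24) (sym (power-even k))))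
  where
  P = 5 ^ (2 ℕ.* suc k ∸ 1)
  arith : ∀ P → 4 ℕ.* P ℕ.* 24 ℕ.+ (19 ℕ.* P ℕ.+ 1) ≡ 23 ℕ.* (5 ℕ.* P) ℕ.+ 1
  arith = ℕSolver.solve-∀

-- U⁰ (Q 1 · W) = Q 5 · U_5 (q W):  A · Q 1 = q · Q 25 = q · Q 5 (q^5), since
-- a(q) Q 1 = 1, and U_5 pulls out the factor Q 5 (q^5).
U⁰-Q₁ : ∀ W → U⁰ (Q 1 ⊛ W) ≈ Q 5 ⊛ U 5 (qShift W)
U⁰-Q₁ W = begin
  U 5 (qShift (aGF ⊛ Q 25) ⊛ (Q 1 ⊛ W))           ≈⟨ U-cong 5 (⊛-comm (qShift (aGF ⊛ Q 25)) (Q 1 ⊛ W)) ⟩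
  U 5 ((Q 1 ⊛ W) ⊛ qShift (aGF ⊛ Q 25))           ≈⟨ U-cong 5 (qShift-⊛ (Q 1 ⊛ W) (aGF ⊛ Q 25)) ⟩
  U 5 (qShift ((Q 1 ⊛ W) ⊛ (aGF ⊛ Q 25)))         ≈⟨ U-cong 5 (shiftN-cong 1 cancel) ⟩
  U 5 (qShift (Q 25 ⊛ W))                         ≈⟨ U-cong 5 (≈-sym (qShift-⊛ (Q 25) W)) ⟩
  U 5 (Q 25 ⊛ qShift W)                           ≈⟨ U-cong 5 (⊛-congʳ (qShift W) (≈-sym (dilate-Q 5 5))) ⟩
  U 5 (dilate 5 (Q 5) ⊛ qShift W)                 ≈⟨ U-dilate 5 (Q 5) (qShift W) ⟩
  Q 5 ⊛ U 5 (qShift W)                            ∎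
  where
  open SetoidReasoning seriesSetoid
  cancel : (Q 1 ⊛ W) ⊛ (aGF ⊛ Q 25) ≈ Q 25 ⊛ W
  cancel = begin
    (Q 1 ⊛ W) ⊛ (aGF ⊛ Q 25)   ≈⟨ solve 4 (λ p w g r → (p ⊕ w) ⊕ (g ⊕ r) ⊜ (g ⊕ p) ⊕ (r ⊕ w)) ≈-refl (Q 1) W aGF (Q 25) ⟩
    (aGF ⊛ Q 1) ⊛ (Q 25 ⊛ W)   ≈⟨ ⊛-congʳ (Q 25 ⊛ W) aGF-⊛-Q₁ ⟩
    one ⊛ (Q 25 ⊛ W)           ≈⟨ ⊛-identityˡ (Q 25 ⊛ W) ⟩
    Q 25 ⊛ W                   ∎

-- U¹ (Q 5 · X) = Q 1 · U_5 X, since Q 5 = Q 1 (q^5).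
U¹-Q₅ : ∀ X → U¹ (Q 5 ⊛ X) ≈ Q 1 ⊛ U 5 X
U¹-Q₅ X = ≈-trans (U-cong 5 (⊛-congʳ X (≈-sym (dilate-Q 5 1)))) (U-dilate 5 (Q 1) X)

-- L_{2n+1} = U⁰ L_{2n}.  For n = 0 write L_0 = 1 = Q 1 · a(q).
odd-step : ∀ k → Lodd (suc k) ≈ U⁰ (Leven k)
odd-step zero = ≈-sym (begin
  U⁰ one                       ≈⟨ U-cong 5 (⊛-congˡ Aq (≈-sym (≈-trans (⊛-comm (Q 1) aGF) aGF-⊛-Q₁))) ⟩
  U⁰ (Q 1 ⊛ aGF)               ≈⟨ U⁰-Q₁ aGF ⟩
  Q 5 ⊛ U 5 (qShift aGF)       ≈⟨ ⊛-congˡ (Q 5) (U₅-qShift aGF) ⟩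
  Lodd 1                       ∎)
  where open SetoidReasoning seriesSetoid
odd-step (suc k) = ≈-sym (begin
  U⁰ (Leven (suc k))                                        ≈⟨ U⁰-Q₁ (qShift (evenCoefficients (suc k))) ⟩
  Q 5 ⊛ U 5 (qShift (qShift (evenCoefficients (suc k))))    ≈⟨ ⊛-congˡ (Q 5) (U₅-qShift (qShift (evenCoefficients (suc k)))) ⟩
  Q 5 ⊛ qShift (λ j → qShift (evenCoefficients (suc k)) (5 ℕ.* j ℕ.+ 4))
                                                            ≈⟨ ⊛-congˡ (Q 5) (shiftN-cong 1 residue-4-of-shift) ⟩
  Lodd (suc (suc k))                                        ∎)
  where
  open SetoidReasoning seriesSetoid
  -- The extra factor q moves residue 3 to residue 4.
  residue-4-of-shift : ∀ j → qShift (evenCoefficients (suc k)) (5 ℕ.* j ℕ.+ 4) ≡ oddCoefficients (suc (suc k)) j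
  residue-4-of-shift j = trans (cong (qShift (evenCoefficients (suc k))) (ℕP.+-suc (5 ℕ.* j) 3))
                               (evenCoefficients-residue-3 k j)

even-step : ∀ k → Leven (suc k) ≈ U¹ (Lodd (suc k))
even-step k = ≈-sym (begin
  U¹ (Lodd (suc k))                                 ≈⟨ U¹-Q₅ (qShift (oddCoefficients (suc k))) ⟩
  Q 1 ⊛ U 5 (qShift (oddCoefficients (suc k)))     ≈⟨ ⊛-congˡ (Q 1) (U₅-qShift (oddCoefficients (suc k))) ⟩
  Q 1 ⊛ qShift (λ j → oddCoefficients (suc k) (5 ℕ.* j ℕ.+ 4))
                                                    ≈⟨ ⊛-congˡ (Q 1) (shiftN-cong 1 (λ j → oddCoefficients-residue-4 k j)) ⟩
  Leven (suc k)                                     ∎)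
  where open SetoidReasoning seriesSetoid

theorem4 : (k : ℕ) → (Lodd (suc k) ≈ U⁰ (Leven k)) × (Leven (suc k) ≈ U¹ (Lodd (suc k)))
theorem4 k = odd-step k , even-step k
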